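{- The sequence $(S(n))_{n\ge 0}$ is not $2$-synchronized.
   Context: For finite words $u,v$ over $\{0,1\}$, $\binom{u}{v}$ is the number of occurrences of $v$ as a (scattered) subword (subsequence) of $u$. For $n\ge 1$, $\mathrm{rep}_2(n)$ is the base-$2$ expansion of $n$ with most significant digit first, and $\mathrm{rep}_2(0)=\varepsilon$. Let $L_2=\{\varepsilon\}\cup 1\{0,1\}^*$ and $S(n)=\#\{v\in L_2 : \binom{\mathrm{rep}_2(n)}{v}>0\}$. For $m,n\in\mathbb{N}$, $\mathrm{rep}_2(m,n)$ is the pair of words obtained from $\mathrm{rep}_2(m)$ and $\mathrm{rep}_2(n)$ by padding the shorter one with leading zeroes so both have length $\max(|\mathrm{rep}_2(m)|,|\mathrm{rep}_2(n)|)$, viewed as a word over the alphabet $\{0,1\}\times\{0,1\}$. A sequence $(s(n))_{n\ge 0}$ of non-negative integers is $2$-synchronized if the language $\{\mathrm{rep}_2(n,s(n)) : n\in\mathbb{N}\}$ is accepted by a finite automaton reading pairs of digits. -}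

module Defs where

open import Data.Nat using (ℕ; zero; suc; _+_; _∸_; _⊔_; _>_; _/_; _%_)
open import Data.Nat.Properties using (_≟_; _≤?_)
open import Data.Bool using (Bool; true; false; if_then_else_; _∧_; T?)
open import Data.Fin using (Fin)
open import Data.List using (List; []; _∷_; length; reverse; replicate; _++_; zip; foldl; map; concatMap; filter; upTo)
open import Data.Product using (_×_; _,_; ∃-syntax)
open import Relation.Nullary.Decidable using (does)
open import Relation.Binary.PropositionalEquality using (_≡_)

-- Binary digits: false = 0, true = 1.
Word : Set
Word = List Bool

-- Least-significant-first binary digits of n, with fuel (fuel n suffices).
bitsLSB : ℕ → ℕ → Word
bitsLSB zero    n = []
bitsLSB (suc f) zero = []
bitsLSB (suc f) n@(suc _) = (if does (n % 2 ≟ 1) then true else false) ∷ bitsLSB f (n / 2)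

-- rep_2(n): most significant digit first; rep_2(0) = ε.
rep2 : ℕ → Word
rep2 n = reverse (bitsLSB n n)

_==ᵇ_ : Bool → Bool → Bool
false ==ᵇ false = true
true  ==ᵇ true  = true
_     ==ᵇ _     = false

-- Binomial coefficient of words: number of occurrences of v as a scattered subword of u.
binom : Word → Word → ℕ
binom u       []      = 1
binom []      (b ∷ v) = 0
binom (a ∷ u) (b ∷ v) = binom u (b ∷ v) + (if a ==ᵇ b then binom u v else 0)

inL2 : Word → Bool
inL2 []          = true
inL2 (true ∷ _)  = true
inL2 (false ∷ _) = false

wordsOfLength : ℕ → List Word
wordsOfLength zero    = [] ∷ []
wordsOfLength (suc k) = concatMap (λ w → (false ∷ w) ∷ (true ∷ w) ∷ []) (wordsOfLength k)

-- All binary words of length at most m (each exactly once).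
wordsUpTo : ℕ → List Word
wordsUpTo m = concatMap wordsOfLength (upTo (suc m))

-- S(n) = #{ v ∈ L_2 : binom(rep_2 n, v) > 0 }.  Any subword of u has length ≤ |u|,
-- so it suffices to enumerate words of length ≤ |rep_2 n|.
S : ℕ → ℕ
S n = length (filter (λ v → T? (inL2 v ∧ does (1 ≤? binom (rep2 n) v)))
                     (wordsUpTo (length (rep2 n))))

pad : ℕ → Word → Word
pad k w = replicate (k ∸ length w) false ++ w

rep2Pair : ℕ → ℕ → List (Bool × Bool)
rep2Pair m n = zip (pad L (rep2 m)) (pad L (rep2 n))
  where L = length (rep2 m) ⊔ length (rep2 n)

record DFA (A : Set) : Set where
  field
    Q      : ℕ
    start  : Fin Q
    δ      : Fin Q → A → Fin Q
    final  : Fin Q → Bool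

accepts : {A : Set} → DFA A → List A → Bool
accepts M w = DFA.final M (foldl (DFA.δ M) (DFA.start M) w)

Synchronized2 : (ℕ → ℕ) → Set
Synchronized2 s = ∃[ M ] ∀ (w : List (Bool × Bool)) →
  (accepts M w ≡ true → ∃[ n ] w ≡ rep2Pair n (s n)) ×
  (∃[ n ] w ≡ rep2Pair n (s n) → accepts M w ≡ true)

-- The binary repunit 1ᵏ has exactly k + 1 subwords in L₂, namely 1ʲ for j ≤ k, so
-- S(2ᵏ − 1) = k + 1.  If an automaton with Q states accepted the graph of S, it would
-- accept rep₂(2ᵏ − 1, k + 1) for k large; this word starts with more than Q copies of
-- the digit pair (1,0), and pumping that block produces rep₂(2ᵏ⁺ᵖ − 1, k + 1) with p > 0,
-- which is not in the graph since S(2ᵏ⁺ᵖ − 1) = k + p + 1.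
module Submission where

open import Defs
open import Relation.Nullary using (¬_)
open import Data.Nat
open import Data.Nat.Properties
open import Data.Nat.DivMod using (+-distrib-/; m*n/n≡m; m*n%n≡0; [m+kn]%n≡m%n; m%n<n; m≡m%n+[m/n]*n; m/n<m; m<n*o⇒m/o<n)
open import Data.Bool using (Bool; true; false; T; if_then_else_; _∧_; _∨_)
open import Data.Fin using (Fin; toℕ)
open import Data.Fin.Properties using (pigeonhole; toℕ<n)
open import Data.List using (List; []; _∷_; length; reverse; replicate; _++_; zip; unzip; foldl; foldr; map; concatMap; filterᵇ; upTo)
open import Data.List.Properties using (length-replicate; length-map; length-upTo; length-reverse; reverse-foldl; unfold-reverse; foldl-++; filter-++; filter-≐; unzip-zip; length-++)
open import Data.List.Relation.Unary.All using (All; []; _∷_)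
open import Data.List.Relation.Unary.All.Properties using (all-upTo)
open import Data.Product using (_×_; _,_; proj₁; proj₂; ∃-syntax)
import Data.Product as Product
open import Data.Product.Properties using (,-injectiveˡ; ,-injectiveʳ)
open import Function using (_∘_)
open import Relation.Nullary.Decidable using (does; T?)
open import Relation.Binary.PropositionalEquality

reverse-replicate : ∀ {A : Set} n (x : A) → reverse (replicate n x) ≡ replicate n x
reverse-replicate zero    x = refl
reverse-replicate (suc n) x =
  trans (unfold-reverse x (replicate n x)) (trans (cong (_++ x ∷ []) (reverse-replicate n x)) (snoc n))
  where
  snoc : ∀ n → replicate n x ++ x ∷ [] ≡ x ∷ replicate n x
  snoc zero    = refl
  snoc (suc n) = cong (x ∷_) (snoc n)

replicate-+ : ∀ {A : Set} m n (x : A) → replicate (m + n) x ≡ replicate m x ++ replicate n x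
replicate-+ zero    n x = refl
replicate-+ (suc m) n x = cong (x ∷_) (replicate-+ m n x)

foldl-replicate-+ : ∀ {A B : Set} (f : B → A → B) b x m n →
  foldl f b (replicate (m + n) x) ≡ foldl f (foldl f b (replicate m x)) (replicate n x)
foldl-replicate-+ f b x m n = trans (cong (foldl f b) (replicate-+ m n x)) (foldl-++ f b (replicate m x) (replicate n x))

zip-replicate-++ : ∀ {A B : Set} (x : A) (y : B) a (r : List B) →
  zip (replicate (a + length r) x) (replicate a y ++ r) ≡ replicate a (x , y) ++ zip (replicate (length r) x) r
zip-replicate-++ x y zero    r = refl
zip-replicate-++ x y (suc a) r = cong ((x , y) ∷_) (zip-replicate-++ x y a r)

filterᵇ-cong : ∀ {A : Set} {p q : A → Bool} → (∀ x → p x ≡ q x) → ∀ xs → filterᵇ p xs ≡ filterᵇ q xs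
filterᵇ-cong p≗q = filter-≐ (T? ∘ _) (T? ∘ _) ((λ {x} → subst T (p≗q x)) , (λ {x} → subst T (sym (p≗q x))))

bit : Bool → ℕ
bit false = 0
bit true  = 1

valueLSB : Word → ℕ
valueLSB = foldr (λ b n → bit b + 2 * n) 0

value : Word → ℕ
value = foldl (λ n b → bit b + 2 * n) 0

value-reverse : ∀ w → value (reverse w) ≡ valueLSB w
value-reverse = reverse-foldl _ 0

value-leadingZeros : ∀ d w → value (replicate d false ++ w) ≡ value w
value-leadingZeros d w = trans (foldl-++ _ 0 (replicate d false) w) (cong (λ n → foldl _ n w) (zeros d))
  where
  zeros : ∀ d → value (replicate d false) ≡ 0
  zeros zero    = refl
  zeros (suc d) = zeros d

bit-digit : ∀ {r} → r < 2 → bit (if does (r ≟ 1) then true else false) ≡ r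
bit-digit {0} _ = refl
bit-digit {1} _ = refl
bit-digit {suc (suc r)} (s≤s (s≤s ()))

valueLSB-bitsLSB : ∀ f n → n ≤ f → valueLSB (bitsLSB f n) ≡ n
valueLSB-bitsLSB zero    zero    _ = refl
valueLSB-bitsLSB (suc f) zero    _ = refl
valueLSB-bitsLSB (suc f) (suc n) (s≤s n≤f) = begin
  bit (if does (suc n % 2 ≟ 1) then true else false) + 2 * valueLSB (bitsLSB f (suc n / 2))
    ≡⟨ cong₂ _+_ (bit-digit (m%n<n (suc n) 2)) (cong (2 *_) (valueLSB-bitsLSB f (suc n / 2) half≤f)) ⟩
  suc n % 2 + 2 * (suc n / 2)
    ≡⟨ cong (suc n % 2 +_) (*-comm 2 (suc n / 2)) ⟩
  suc n % 2 + suc n / 2 * 2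
    ≡⟨ sym (m≡m%n+[m/n]*n (suc n) 2) ⟩
  suc n ∎
  where
  open ≡-Reasoning
  half≤f : suc n / 2 ≤ f
  half≤f = ≤-trans (≤-pred (m/n<m (suc n) 2 ≤-refl)) n≤f

value-rep2 : ∀ n → value (rep2 n) ≡ n
value-rep2 n = trans (value-reverse (bitsLSB n n)) (valueLSB-bitsLSB n n ≤-refl)

length-bitsLSB : ∀ f {x} m → x < 2 ^ m → length (bitsLSB f x) ≤ m
length-bitsLSB zero    {x}     m       _ = z≤n
length-bitsLSB (suc f) {zero}  m       _ = z≤n
length-bitsLSB (suc f) {suc x} zero    (s≤s ())
length-bitsLSB (suc f) {suc x} (suc m) x<2^[1+m] =
  s≤s (length-bitsLSB f m (m<n*o⇒m/o<n (subst (suc x <_) (*-comm 2 (2 ^ m)) x<2^[1+m])))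

length-rep2 : ∀ {x} m → x < 2 ^ m → length (rep2 x) ≤ m
length-rep2 {x} m x<2^m = ≤-trans (≤-reflexive (length-reverse (bitsLSB x x))) (length-bitsLSB x m x<2^m)

n<2^n : ∀ n → n < 2 ^ n
n<2^n zero    = s≤s z≤n
n<2^n (suc n) = +-mono-≤ (m^n>0 2 n) (≤-trans (n<2^n n) (m≤m+n (2 ^ n) 0))

length-rep2-sublinear : ∀ c → ∃[ k ] c + length (rep2 (suc k)) ≤ k
length-rep2-sublinear c = K , (begin
  c + length (rep2 (suc K)) ≤⟨ +-monoʳ-≤ c (length-rep2 (2 + c) 1+K<2K) ⟩
  c + (2 + c)               ≡⟨ +-suc c (suc c) ⟩
  suc c + suc c             ≡⟨ cong (suc c +_) (sym (+-identityʳ (suc c))) ⟩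
  2 * suc c                 ≤⟨ *-monoʳ-≤ 2 (n<2^n c) ⟩
  K                         ∎)
  where
  open ≤-Reasoning
  K = 2 ^ suc c
  1+K<2K : suc K < 2 * K
  1+K<2K = ≤-trans (≤-reflexive (+-comm 2 K)) (+-monoʳ-≤ K (≤-trans (*-monoʳ-≤ 2 (m^n>0 2 c)) (m≤m+n K 0)))

-- repunit k = 2ᵏ − 1, whose binary expansion is 1ᵏ.
repunit : ℕ → ℕ
repunit zero    = 0
repunit (suc k) = suc (2 * repunit k)

[1+2n]%2≡1 : ∀ n → suc (2 * n) % 2 ≡ 1
[1+2n]%2≡1 n rewrite *-comm 2 n = [m+kn]%n≡m%n 1 n 2

[1+2n]/2≡n : ∀ n → suc (2 * n) / 2 ≡ n
[1+2n]/2≡n n rewrite *-comm 2 n =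
  trans (+-distrib-/ 1 (n * 2) (subst (λ r → 1 + r < 2) (sym (m*n%n≡0 n 2)) ≤-refl)) (m*n/n≡m n 2)

bitsLSB-repunit : ∀ k f → repunit k ≤ f → bitsLSB f (repunit k) ≡ replicate k true
bitsLSB-repunit zero    zero    _ = refl
bitsLSB-repunit zero    (suc f) _ = refl
bitsLSB-repunit (suc k) (suc f) (s≤s 2r≤f) rewrite [1+2n]%2≡1 (repunit k) | [1+2n]/2≡n (repunit k) =
  cong (true ∷_) (bitsLSB-repunit k f (≤-trans (m≤m+n (repunit k) _) 2r≤f))

rep2-repunit : ∀ k → rep2 (repunit k) ≡ replicate k true
rep2-repunit k = trans (cong reverse (bitsLSB-repunit k (repunit k) ≤-refl)) (reverse-replicate k true)

positive : ℕ → Bool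
positive n = does (1 ≤? n)

positive-+ : ∀ m n → positive (m + n) ≡ positive m ∨ positive n
positive-+ zero    n = refl
positive-+ (suc m) n = refl

ones≤ᵇ : ℕ → Word → Bool
ones≤ᵇ k       []          = true
ones≤ᵇ k       (false ∷ _) = false
ones≤ᵇ zero    (true ∷ _)  = false
ones≤ᵇ (suc k) (true ∷ v)  = ones≤ᵇ k v

ones≤ᵇ-absorb : ∀ k v → ones≤ᵇ k (true ∷ v) ∨ ones≤ᵇ k v ≡ ones≤ᵇ k v
ones≤ᵇ-absorb zero    v            = refl
ones≤ᵇ-absorb (suc k) []           = refl
ones≤ᵇ-absorb (suc k) (false ∷ v)  = refl
ones≤ᵇ-absorb (suc k) (true ∷ v)   = ones≤ᵇ-absorb k v

binom-ones-zero : ∀ k v → binom (replicate k true) (false ∷ v) ≡ 0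
binom-ones-zero zero    v = refl
binom-ones-zero (suc k) v = trans (+-identityʳ _) (binom-ones-zero k v)

positive-binom-ones : ∀ k v → positive (binom (replicate k true) v) ≡ ones≤ᵇ k v
positive-binom-ones k       []          = refl
positive-binom-ones k       (false ∷ v) = cong positive (binom-ones-zero k v)
positive-binom-ones zero    (true ∷ v)  = refl
positive-binom-ones (suc k) (true ∷ v)  = begin
  positive (binom (replicate k true) (true ∷ v) + binom (replicate k true) v)
    ≡⟨ positive-+ (binom (replicate k true) (true ∷ v)) _ ⟩
  positive (binom (replicate k true) (true ∷ v)) ∨ positive (binom (replicate k true) v)
    ≡⟨ cong₂ _∨_ (positive-binom-ones k (true ∷ v)) (positive-binom-ones k v) ⟩
  ones≤ᵇ k (true ∷ v) ∨ ones≤ᵇ k v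
    ≡⟨ ones≤ᵇ-absorb k v ⟩
  ones≤ᵇ k v ∎
  where open ≡-Reasoning

inL2-ones≤ᵇ : ∀ k v → inL2 v ∧ ones≤ᵇ k v ≡ ones≤ᵇ k v
inL2-ones≤ᵇ k []          = refl
inL2-ones≤ᵇ k (true ∷ v)  = refl
inL2-ones≤ᵇ k (false ∷ v) = refl

filter-ones≤ᵇ-extend : ∀ k ws →
  filterᵇ (ones≤ᵇ (suc k)) (concatMap (λ w → (false ∷ w) ∷ (true ∷ w) ∷ []) ws)
    ≡ map (true ∷_) (filterᵇ (ones≤ᵇ k) ws)
filter-ones≤ᵇ-extend k []       = refl
filter-ones≤ᵇ-extend k (w ∷ ws) with ones≤ᵇ k w
... | true  = cong ((true ∷ w) ∷_) (filter-ones≤ᵇ-extend k ws)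
... | false = filter-ones≤ᵇ-extend k ws

filter-ones≤ᵇ-wordsOfLength : ∀ {k} j → j ≤ k → filterᵇ (ones≤ᵇ k) (wordsOfLength j) ≡ replicate j true ∷ []
filter-ones≤ᵇ-wordsOfLength zero    _         = refl
filter-ones≤ᵇ-wordsOfLength {suc k} (suc j) (s≤s j≤k) =
  trans (filter-ones≤ᵇ-extend k (wordsOfLength j)) (cong (map (true ∷_)) (filter-ones≤ᵇ-wordsOfLength j j≤k))

filter-ones≤ᵇ-concat : ∀ {k js} → All (_< suc k) js →
  filterᵇ (ones≤ᵇ k) (concatMap wordsOfLength js) ≡ map (λ j → replicate j true) js
filter-ones≤ᵇ-concat []                          = refl
filter-ones≤ᵇ-concat {k} {j ∷ js} (j<1+k ∷ js<1+k) =
  trans (filter-++ (T? ∘ ones≤ᵇ k) (wordsOfLength j) (concatMap wordsOfLength js))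
        (cong₂ _++_ (filter-ones≤ᵇ-wordsOfLength j (≤-pred j<1+k)) (filter-ones≤ᵇ-concat js<1+k))

countL2Subwords : Word → ℕ
countL2Subwords u = length (filterᵇ (λ v → inL2 v ∧ positive (binom u v)) (wordsUpTo (length u)))

countL2Subwords-ones : ∀ k → countL2Subwords (replicate k true) ≡ suc k
countL2Subwords-ones k = begin
  length (filterᵇ inL2∧subword (wordsUpTo (length (replicate k true))))
    ≡⟨ cong (λ m → length (filterᵇ inL2∧subword (wordsUpTo m))) (length-replicate k) ⟩
  length (filterᵇ inL2∧subword (wordsUpTo k))
    ≡⟨ cong length (filterᵇ-cong inL2∧subword≗ones≤ᵇ (wordsUpTo k)) ⟩
  length (filterᵇ (ones≤ᵇ k) (wordsUpTo k))
    ≡⟨ cong length (filter-ones≤ᵇ-concat (all-upTo (suc k))) ⟩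
  length (map (λ j → replicate j true) (upTo (suc k)))
    ≡⟨ trans (length-map _ (upTo (suc k))) (length-upTo (suc k)) ⟩
  suc k ∎
  where
  open ≡-Reasoning
  inL2∧subword : Word → Bool
  inL2∧subword v = inL2 v ∧ positive (binom (replicate k true) v)
  inL2∧subword≗ones≤ᵇ : ∀ v → inL2∧subword v ≡ ones≤ᵇ k v
  inL2∧subword≗ones≤ᵇ v = trans (cong (inL2 v ∧_) (positive-binom-ones k v)) (inL2-ones≤ᵇ k v)

S-repunit : ∀ k → S (repunit k) ≡ suc k
S-repunit k = trans (cong countL2Subwords (rep2-repunit k)) (countL2Subwords-ones k)

decodePair : List (Bool × Bool) → ℕ × ℕ
decodePair = Product.map value value ∘ unzip

length-pad : ∀ k (u : Word) → length u ≤ k → length (pad k u) ≡ k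
length-pad k u u≤k = begin
  length (pad k u)                                   ≡⟨ length-++ (replicate (k ∸ length u) false) ⟩
  length (replicate (k ∸ length u) false) + length u ≡⟨ cong (_+ length u) (length-replicate (k ∸ length u)) ⟩
  k ∸ length u + length u                            ≡⟨ m∸n+n≡m u≤k ⟩
  k                                                  ∎
  where open ≡-Reasoning

decodePair-rep2Pair : ∀ m n → decodePair (rep2Pair m n) ≡ (m , n)
decodePair-rep2Pair m n = begin
  decodePair (zip (pad L (rep2 m)) (pad L (rep2 n)))
    ≡⟨ cong (Product.map value value) (unzip-zip (pad L (rep2 m)) (pad L (rep2 n)) equalLengths) ⟩
  (value (pad L (rep2 m)) , value (pad L (rep2 n)))
    ≡⟨ cong₂ _,_ (value-leadingZeros (L ∸ length (rep2 m)) (rep2 m)) (value-leadingZeros (L ∸ length (rep2 n)) (rep2 n)) ⟩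
  (value (rep2 m) , value (rep2 n))
    ≡⟨ cong₂ _,_ (value-rep2 m) (value-rep2 n) ⟩
  (m , n) ∎
  where
  open ≡-Reasoning
  L = length (rep2 m) ⊔ length (rep2 n)
  equalLengths : length (pad L (rep2 m)) ≡ length (pad L (rep2 n))
  equalLengths = trans (length-pad L (rep2 m) (m≤m⊔n _ _)) (sym (length-pad L (rep2 n) (m≤n⊔m _ _)))

rep2Pair-injective : ∀ {m n m′ n′} → rep2Pair m n ≡ rep2Pair m′ n′ → m ≡ m′ × n ≡ n′
rep2Pair-injective {m} {n} {m′} {n′} eq = ,-injectiveˡ pairs , ,-injectiveʳ pairs
  where
  pairs : (m , n) ≡ (m′ , n′)
  pairs = trans (sym (decodePair-rep2Pair m n)) (trans (cong decodePair eq) (decodePair-rep2Pair m′ n′))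

rep2Pair-repunit : ∀ k y → length (rep2 y) ≤ k →
  rep2Pair (repunit k) y
    ≡ replicate (k ∸ length (rep2 y)) (true , false) ++ zip (replicate (length (rep2 y)) true) (rep2 y)
rep2Pair-repunit k y l≤k
  rewrite rep2-repunit k | length-replicate k {true} | m≥n⇒m⊔n≡m l≤k | n∸n≡0 k =
  trans (cong (λ m → zip (replicate m true) (replicate (k ∸ length (rep2 y)) false ++ rep2 y)) (sym (m∸n+n≡m l≤k)))
        (zip-replicate-++ true false (k ∸ length (rep2 y)) (rep2 y))

module _ {A : Set} (M : DFA A) where
  open DFA M

  pump-replicate : ∀ s x {a} → Q ≤ a →
    ∃[ p ] 0 < p × foldl δ s (replicate (a + p) x) ≡ foldl δ s (replicate a x)
  pump-replicate s x {a} Q≤a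
    with i , j , i<j , sameState ← pigeonhole (n<1+n Q) (λ i → foldl δ s (replicate (toℕ i) x)) =
    toℕ j ∸ toℕ i , m<n⇒0<n∸m i<j , (begin
      after (a + (toℕ j ∸ toℕ i))     ≡⟨ cong after shift ⟩
      after (toℕ j + (a ∸ toℕ i))     ≡⟨ foldl-replicate-+ δ s x (toℕ j) _ ⟩
      foldl δ (after (toℕ j)) rest    ≡⟨ cong (λ t → foldl δ t rest) (sym sameState) ⟩
      foldl δ (after (toℕ i)) rest    ≡⟨ sym (foldl-replicate-+ δ s x (toℕ i) _) ⟩
      after (toℕ i + (a ∸ toℕ i))     ≡⟨ cong after (m+[n∸m]≡n i≤a) ⟩
      after a                         ∎)
    where
    open ≡-Reasoning
    after : ℕ → Fin Q
    after t = foldl δ s (replicate t x)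
    i≤a : toℕ i ≤ a
    i≤a = ≤-trans (<⇒≤ i<j) (≤-trans (≤-pred (toℕ<n j)) Q≤a)
    rest : List A
    rest = replicate (a ∸ toℕ i) x
    shift : a + (toℕ j ∸ toℕ i) ≡ toℕ j + (a ∸ toℕ i)
    shift = trans (sym (+-∸-assoc a (<⇒≤ i<j)))
           (trans (cong (_∸ toℕ i) (+-comm a (toℕ j))) (+-∸-assoc (toℕ j) i≤a))

  accepts-pump : ∀ x {a} → Q ≤ a →
    ∃[ p ] 0 < p × (∀ w → accepts M (replicate (a + p) x ++ w) ≡ accepts M (replicate a x ++ w))
  accepts-pump x {a} Q≤a with p , 0<p , loop ← pump-replicate start x Q≤a = p , 0<p , λ w → cong final (begin
    foldl δ start (replicate (a + p) x ++ w)           ≡⟨ foldl-++ δ start (replicate (a + p) x) w ⟩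
    foldl δ (foldl δ start (replicate (a + p) x)) w    ≡⟨ cong (λ t → foldl δ t w) loop ⟩
    foldl δ (foldl δ start (replicate a x)) w          ≡⟨ sym (foldl-++ δ start (replicate a x) w) ⟩
    foldl δ start (replicate a x ++ w)                 ∎)
    where open ≡-Reasoning

accepts-graph : ∀ {s} ((M , _) : Synchronized2 s) n → accepts M (rep2Pair n (s n)) ≡ true
accepts-graph (M , spec) n = proj₂ (spec _) (n , refl)

accepted⇒graph : ∀ {s} ((M , _) : Synchronized2 s) {n y} → accepts M (rep2Pair n y) ≡ true → y ≡ s n
accepted⇒graph {s} (M , spec) acc with m , eq ← proj₁ (spec _) acc
  with n≡m , y≡sm ← rep2Pair-injective eq = trans y≡sm (cong s (sym n≡m))

proposition6p2 : ¬ Synchronized2 S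
proposition6p2 sync@(M , _)
  with K , Q+l≤K ← length-rep2-sublinear (DFA.Q M)
  with p , 0<p , pumped ← accepts-pump M (true , false) (m+n≤o⇒m≤o∸n (DFA.Q M) Q+l≤K) =
  <⇒≢ (m<m+n K 0<p) (suc-injective (trans suc-K-in-graph (S-repunit (K + p))))
  where
  open ≡-Reasoning
  l : ℕ
  l = length (rep2 (suc K))
  l≤K : l ≤ K
  l≤K = m+n≤o⇒n≤o (DFA.Q M) Q+l≤K
  tail : List (Bool × Bool)
  tail = zip (replicate l true) (rep2 (suc K))
  suc-K-in-graph : suc K ≡ S (repunit (K + p))
  suc-K-in-graph = accepted⇒graph {S} sync {repunit (K + p)} {suc K} (begin
    accepts M (rep2Pair (repunit (K + p)) (suc K))
      ≡⟨ cong (accepts M) (rep2Pair-repunit (K + p) (suc K) (≤-trans l≤K (m≤m+n K p))) ⟩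
    accepts M (replicate (K + p ∸ l) (true , false) ++ tail)
      ≡⟨ cong (λ a → accepts M (replicate a (true , false) ++ tail)) (+-∸-comm p l≤K) ⟩
    accepts M (replicate (K ∸ l + p) (true , false) ++ tail)
      ≡⟨ pumped tail ⟩
    accepts M (replicate (K ∸ l) (true , false) ++ tail)
      ≡⟨ cong (accepts M) (sym (rep2Pair-repunit K (suc K) l≤K)) ⟩
    accepts M (rep2Pair (repunit K) (suc K))
      ≡⟨ cong (accepts M ∘ rep2Pair (repunit K)) (sym (S-repunit K)) ⟩
    accepts M (rep2Pair (repunit K) (S (repunit K)))
      ≡⟨ accepts-graph {S} sync (repunit K) ⟩
    true ∎)
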